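{- Let $G=(V,E,c)$ be an undirected graph with positive integer edge weights and terminal set $T\subseteq V$. Let $v\in V\setminus T$ and let $(V_v,V\setminus V_v)$ be the largest minimum isolating cut of $v$ and $T$, i.e. a cut of minimum weight $\lambda(G,v,T)$ among all cuts $(A,V\setminus A)$ with $v\in A$ and $T\subseteq V\setminus A$, chosen with $|V_v|$ maximum. Then there exists at least one minimum multiterminal cut of $G$ in which every vertex $x\in V_v$ lies in the same block as $v$.
   Context: For terminals $T=\{t_1,\dots,t_k\}$, a multiterminal cut is a partition of $V$ into blocks $\mathcal{V}_1,\dots,\mathcal{V}_k$ with $t_j\in\mathcal{V}_j$; its weight is the total weight of edges whose endpoints lie in different blocks, and a minimum multiterminal cut is one of minimum weight. The weight of a cut $(A,V\setminus A)$ is the total weight of edges with one endpoint in $A$ and the other in $V\setminus A$. -}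

module Defs where

open import Data.Nat using (ℕ; zero; suc; _+_; _≤_; _<_)
open import Data.Fin using (Fin)
open import Data.Fin.Properties using (_≟_)
open import Data.Fin.Subset using (Subset; _∈_; _∉_; ∣_∣)
open import Data.Vec using (lookup)
open import Data.Bool using (Bool; true; false)
open import Data.Bool.Properties renaming (_≟_ to _≟ᵇ_)
open import Data.List using (List; []; _∷_)
open import Data.List.Relation.Unary.All using (All)
open import Data.Product using (_×_; _,_; Σ; ∃)
open import Function.Definitions using (Injective)
open import Relation.Binary.PropositionalEquality using (_≡_)
open import Relation.Nullary using (¬_; yes; no)

-- An undirected edge-weighted (multi)graph on vertex set Fin n:
-- a list of edges (u , v , c) with weight c.
Edge : ℕ → Set
Edge n = Fin n × Fin n × ℕ

record Graph (n : ℕ) : Set where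
  constructor mkGraph
  field
    edges    : List (Edge n)
    positive : All (λ e → let (_ , _ , c) = e in 0 < c) edges
open Graph public

cutWeightBy : ∀ {n} {B : Set} → ((a b : B) → Bool) → (Fin n → B) → List (Edge n) → ℕ
cutWeightBy eq f [] = 0
cutWeightBy eq f ((u , v , c) ∷ es) with eq (f u) (f v)
... | true  = cutWeightBy eq f es
... | false = c + cutWeightBy eq f es

finEq : ∀ {k} → Fin k → Fin k → Bool
finEq a b with a ≟ b
... | yes _ = true
... | no _  = false

boolEq : Bool → Bool → Bool
boolEq a b with a ≟ᵇ b
... | yes _ = true
... | no _  = false

cutWeight : ∀ {n} → Graph n → Subset n → ℕ
cutWeight G A = cutWeightBy boolEq (λ x → lookup A x) (edges G)

IsIsolating : ∀ {n k} → (Fin k → Fin n) → Fin n → Subset n → Set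
IsIsolating t v A = v ∈ A × (∀ j → t j ∉ A)

IsMinIsolating : ∀ {n k} → Graph n → (Fin k → Fin n) → Fin n → Subset n → Set
IsMinIsolating G t v A =
  IsIsolating t v A × (∀ B → IsIsolating t v B → cutWeight G A ≤ cutWeight G B)

IsLargestMinIsolating : ∀ {n k} → Graph n → (Fin k → Fin n) → Fin n → Subset n → Set
IsLargestMinIsolating G t v A =
  IsMinIsolating G t v A × (∀ B → IsMinIsolating G t v B → ∣ B ∣ ≤ ∣ A ∣)

-- Multiterminal cut: partition V into blocks V_1..V_k, given as the block-index
-- map f : V → Fin k, with t_j ∈ V_j.
IsMultiterminalCut : ∀ {n k} → (Fin k → Fin n) → (Fin n → Fin k) → Set
IsMultiterminalCut t f = ∀ j → f (t j) ≡ j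

mtcWeight : ∀ {n k} → Graph n → (Fin n → Fin k) → ℕ
mtcWeight G f = cutWeightBy finEq f (edges G)

IsMinMultiterminalCut : ∀ {n k} → Graph n → (Fin k → Fin n) → (Fin n → Fin k) → Set
IsMinMultiterminalCut G t f =
  IsMultiterminalCut t f × (∀ g → IsMultiterminalCut t g → mtcWeight G f ≤ mtcWeight G g)

-- Take any minimum multiterminal cut f and let j be the block of v. Moving all of
-- V_v into block j gives a multiterminal cut f′, and edge by edge one checks the
-- posimodularity-type exchange inequality
--   w(f′) + w(δ(V_v ∩ f⁻¹ j)) ≤ w(f) + w(δ(V_v)).
-- Since V_v ∩ f⁻¹ j is again an isolating cut of v and T, minimality of V_v gives
-- w(δ(V_v)) ≤ w(δ(V_v ∩ f⁻¹ j)), hence w(f′) ≤ w(f), so f′ is also minimum.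
module Submission where

open import Defs
open import Algebra.Properties.CommutativeSemigroup using (interchange)
open import Data.Bool using (Bool; true; false; _∧_; if_then_else_)
open import Data.Empty using (⊥-elim)
open import Data.Fin using (Fin; zero; suc; fromℕ<)
open import Data.Fin.Properties using (any?; all?) renaming (_≟_ to _≟ᶠ_)
open import Data.Fin.Subset using (Subset; _∈_; _∩_)
open import Data.Fin.Subset.Properties using (x∈p∩q⁺; x∈p∩q⁻)
open import Data.List using ([]; _∷_)
open import Data.Nat using (ℕ; zero; suc; _≤_; _<_; _<?_; _+_; z≤n)
open import Data.Nat.Induction using (<-wellFounded)
open import Data.Nat.Properties
  using (≤-refl; ≤-reflexive; +-identityʳ; ≤-trans; ≮⇒≥; m≤n+m; m≤m+n; +-mono-≤; +-monoʳ-≤; +-cancelʳ-≤;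
         +-commutativeSemigroup)
open import Data.Product using (Σ; ∃; _×_; _,_; proj₁)
open import Data.Vec using (lookup; tabulate)
open import Data.Vec.Properties using (lookup⇒[]=; []=⇒lookup; lookup∘tabulate; lookup-zipWith)
open import Data.Vec.Functional using (head; tail) renaming (_∷_ to _∷ᵛ_)
open import Function using (_∘_)
open import Function.Definitions using (Injective)
open import Induction.WellFounded using (Acc; acc)
open import Relation.Binary.PropositionalEquality
  using (_≡_; _≢_; refl; sym; trans; cong; cong₂; subst; module ≡-Reasoning)
open import Relation.Nullary using (¬_; Dec; yes; no)
open import Relation.Nullary.Decidable using (_×-dec_)

private
  variable
    n k : ℕ
    B : Set

crossingCost : Bool → ℕ → ℕ
crossingCost same c = if same then 0 else c

crossingCost≤ : ∀ same c → crossingCost same c ≤ c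
crossingCost≤ true  c = z≤n
crossingCost≤ false c = ≤-refl

edgeCost : (B → B → Bool) → (Fin n → B) → Edge n → ℕ
edgeCost eq f (u , x , c) = crossingCost (eq (f u) (f x)) c

cutWeightBy-∷ : ∀ (eq : B → B → Bool) (f : Fin n → B) e es →
                cutWeightBy eq f (e ∷ es) ≡ edgeCost eq f e + cutWeightBy eq f es
cutWeightBy-∷ eq f (u , x , c) es with eq (f u) (f x)
... | true  = refl
... | false = refl

cutWeightBy-cong : ∀ (eq : B → B → Bool) {f g : Fin n → B} →
                   (∀ y → f y ≡ g y) → ∀ es → cutWeightBy eq f es ≡ cutWeightBy eq g es
cutWeightBy-cong eq f≗g [] = refl
cutWeightBy-cong eq {f} {g} f≗g (e ∷ es) = begin
  cutWeightBy eq f (e ∷ es)             ≡⟨ cutWeightBy-∷ eq f e es ⟩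
  edgeCost eq f e + cutWeightBy eq f es ≡⟨ cong₂ _+_ (edgeCost-cong e) (cutWeightBy-cong eq f≗g es) ⟩
  edgeCost eq g e + cutWeightBy eq g es ≡⟨ sym (cutWeightBy-∷ eq g e es) ⟩
  cutWeightBy eq g (e ∷ es)             ∎
  where
  open ≡-Reasoning
  edgeCost-cong : ∀ e → edgeCost eq f e ≡ edgeCost eq g e
  edgeCost-cong (u , x , c) = cong₂ (λ a b → crossingCost (eq a b) c) (f≗g u) (f≗g x)

cutWeightBy-sum-≤ : ∀ {B₁ B₂ B₃ B₄ : Set}
  (eq₁ : B₁ → B₁ → Bool) (eq₂ : B₂ → B₂ → Bool) (eq₃ : B₃ → B₃ → Bool) (eq₄ : B₄ → B₄ → Bool)
  (f₁ : Fin n → B₁) (f₂ : Fin n → B₂) (f₃ : Fin n → B₃) (f₄ : Fin n → B₄) →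
  (∀ e → edgeCost eq₁ f₁ e + edgeCost eq₂ f₂ e ≤ edgeCost eq₃ f₃ e + edgeCost eq₄ f₄ e) →
  ∀ es → cutWeightBy eq₁ f₁ es + cutWeightBy eq₂ f₂ es ≤ cutWeightBy eq₃ f₃ es + cutWeightBy eq₄ f₄ es
cutWeightBy-sum-≤ eq₁ eq₂ eq₃ eq₄ f₁ f₂ f₃ f₄ edge≤ [] = z≤n
cutWeightBy-sum-≤ eq₁ eq₂ eq₃ eq₄ f₁ f₂ f₃ f₄ edge≤ (e ∷ es)
  rewrite cutWeightBy-∷ eq₁ f₁ e es | cutWeightBy-∷ eq₂ f₂ e es
        | cutWeightBy-∷ eq₃ f₃ e es | cutWeightBy-∷ eq₄ f₄ e es
        | interchange +-commutativeSemigroup (edgeCost eq₁ f₁ e) (cutWeightBy eq₁ f₁ es)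
                                             (edgeCost eq₂ f₂ e) (cutWeightBy eq₂ f₂ es)
        | interchange +-commutativeSemigroup (edgeCost eq₃ f₃ e) (cutWeightBy eq₃ f₃ es)
                                             (edgeCost eq₄ f₄ e) (cutWeightBy eq₄ f₄ es)
  = +-mono-≤ (edge≤ e) (cutWeightBy-sum-≤ eq₁ eq₂ eq₃ eq₄ f₁ f₂ f₃ f₄ edge≤ es)

finEq-refl : (a : Fin k) → finEq a a ≡ true
finEq-refl a with a ≟ᶠ a
... | yes _   = refl
... | no  a≢a = ⊥-elim (a≢a refl)

finEq-≢ : {a b : Fin k} → a ≢ b → finEq a b ≡ false
finEq-≢ {a = a} {b} a≢b with a ≟ᶠ b
... | yes a≡b = ⊥-elim (a≢b a≡b)
... | no  _   = refl

boolEq-refl : ∀ a → boolEq a a ≡ true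
boolEq-refl true  = refl
boolEq-refl false = refl

moveTo : Subset n → Fin k → (Fin n → Fin k) → Fin n → Fin k
moveTo S j f y = if lookup S y then j else f y

preimage : (Fin n → Fin k) → Fin k → Subset n
preimage f j = tabulate (λ y → finEq (f y) j)

lookup-∩-preimage : ∀ (S : Subset n) (f : Fin n → Fin k) j y →
                    lookup (S ∩ preimage f j) y ≡ lookup S y ∧ finEq (f y) j
lookup-∩-preimage S f j y =
  trans (lookup-zipWith _∧_ y S (preimage f j))
        (cong (lookup S y ∧_) (lookup∘tabulate (λ z → finEq (f z) j) y))

-- An edge inside S is uncut after the move, and cut by S ∩ f⁻¹ j only if f cuts it;
-- an edge leaving S is paid for by δ(S), and counted twice only if f cuts it as well.
moveTo-exchange-edge : ∀ c (a b : Bool) (fu fx j : Fin k) →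
  crossingCost (finEq (if a then j else fu) (if b then j else fx)) c
    + crossingCost (boolEq (a ∧ finEq fu j) (b ∧ finEq fx j)) c
  ≤ crossingCost (finEq fu fx) c + crossingCost (boolEq a b) c
moveTo-exchange-edge c false false fu fx j = ≤-refl
moveTo-exchange-edge c true true fu fx j rewrite finEq-refl j = inside (fu ≟ᶠ fx)
  where
  inside : Dec (fu ≡ fx) → crossingCost (boolEq (finEq fu j) (finEq fx j)) c ≤ crossingCost (finEq fu fx) c + 0
  inside (yes refl) rewrite boolEq-refl (finEq fu j) = z≤n
  inside (no fu≢fx) rewrite finEq-≢ fu≢fx = ≤-trans (crossingCost≤ _ c) (m≤m+n c 0)
moveTo-exchange-edge c true false fu fx j = leaving (fu ≟ᶠ j) (fx ≟ᶠ j)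
  where
  leaving : Dec (fu ≡ j) → Dec (fx ≡ j) →
    crossingCost (finEq j fx) c + crossingCost (boolEq (finEq fu j) false) c ≤ crossingCost (finEq fu fx) c + c
  leaving _ (yes refl) rewrite finEq-refl fx = ≤-trans (crossingCost≤ _ c) (m≤n+m c _)
  leaving (yes refl) (no fx≢j) rewrite finEq-refl fu | finEq-≢ (fx≢j ∘ sym) = ≤-refl
  leaving (no fu≢j) (no fx≢j) rewrite finEq-≢ (fx≢j ∘ sym) | finEq-≢ fu≢j = ≤-trans (≤-reflexive (+-identityʳ c)) (m≤n+m c _)
moveTo-exchange-edge c false true fu fx j = entering (fu ≟ᶠ j) (fx ≟ᶠ j)
  where
  entering : Dec (fu ≡ j) → Dec (fx ≡ j) →
    crossingCost (finEq fu j) c + crossingCost (boolEq false (finEq fx j)) c ≤ crossingCost (finEq fu fx) c + c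
  entering (yes refl) _ rewrite finEq-refl fu = ≤-trans (crossingCost≤ _ c) (m≤n+m c _)
  entering (no fu≢j) (yes refl) rewrite finEq-refl fx | finEq-≢ fu≢j = ≤-refl
  entering (no fu≢j) (no fx≢j) rewrite finEq-≢ fu≢j | finEq-≢ fx≢j = ≤-trans (≤-reflexive (+-identityʳ c)) (m≤n+m c _)

moveTo-exchange : ∀ (G : Graph n) (S : Subset n) (j : Fin k) (f : Fin n → Fin k) →
  mtcWeight G (moveTo S j f) + cutWeight G (S ∩ preimage f j) ≤ mtcWeight G f + cutWeight G S
moveTo-exchange G S j f =
  subst (λ w → mtcWeight G (moveTo S j f) + w ≤ mtcWeight G f + cutWeight G S)
        (sym (cutWeightBy-cong boolEq (lookup-∩-preimage S f j) (edges G)))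
        (cutWeightBy-sum-≤ finEq boolEq finEq boolEq
          (moveTo S j f) (λ y → lookup S y ∧ finEq (f y) j) f (lookup S) edge≤ (edges G))
  where
  edge≤ : ∀ e → edgeCost finEq (moveTo S j f) e + edgeCost boolEq (λ y → lookup S y ∧ finEq (f y) j) e
              ≤ edgeCost finEq f e + edgeCost boolEq (lookup S) e
  edge≤ (u , x , c) = moveTo-exchange-edge c (lookup S u) (lookup S x) (f u) (f x) j

∉⇒lookup≡false : ∀ (S : Subset n) {y} → ¬ y ∈ S → lookup S y ≡ false
∉⇒lookup≡false S {y} y∉S with lookup S y in eq
... | true  = ⊥-elim (y∉S (lookup⇒[]= y S eq))
... | false = refl

moveTo-∈ : ∀ {S : Subset n} {x} (j : Fin k) (f : Fin n → Fin k) → x ∈ S → moveTo S j f x ≡ j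
moveTo-∈ {S = S} {x} j f x∈S rewrite []=⇒lookup x∈S = refl

moveTo-isMultiterminalCut : ∀ {t : Fin k → Fin n} {S : Subset n} j f →
  (∀ i → ¬ t i ∈ S) → IsMultiterminalCut t f → IsMultiterminalCut t (moveTo S j f)
moveTo-isMultiterminalCut {S = S} j f T∩S≡∅ isCut i rewrite ∉⇒lookup≡false S (T∩S≡∅ i) = isCut i

∈-preimage : ∀ (f : Fin n → Fin k) x → x ∈ preimage f (f x)
∈-preimage f x = lookup⇒[]= x (preimage f (f x))
  (trans (lookup∘tabulate (λ y → finEq (f y) (f x)) x) (finEq-refl (f x)))

∩-isIsolating : ∀ {t : Fin k → Fin n} {v} {S P : Subset n} →
  IsIsolating t v S → v ∈ P → IsIsolating t v (S ∩ P)
∩-isIsolating {S = S} {P} (v∈S , T∩S≡∅) v∈P =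
  x∈p∩q⁺ (v∈S , v∈P) , λ i tᵢ∈S∩P → T∩S≡∅ i (proj₁ (x∈p∩q⁻ S P tᵢ∈S∩P))

moveTo-isMinMultiterminalCut : ∀ (G : Graph n) {t : Fin k → Fin n} {v S} f →
  IsMinIsolating G t v S → IsMinMultiterminalCut G t f →
  IsMinMultiterminalCut G t (moveTo S (f v) f)
moveTo-isMinMultiterminalCut G {v = v} {S} f (isolating@(_ , T∩S≡∅) , minimal) (isCut , minimum) =
  moveTo-isMultiterminalCut (f v) f T∩S≡∅ isCut , λ g isCutᵍ → ≤-trans moved≤f (minimum g isCutᵍ)
  where
  moved≤f : mtcWeight G (moveTo S (f v) f) ≤ mtcWeight G f
  moved≤f = +-cancelʳ-≤ _ _ _
    (≤-trans (moveTo-exchange G S (f v) f)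
             (+-monoʳ-≤ (mtcWeight G f) (minimal _ (∩-isIsolating isolating (∈-preimage f v)))))

∃-function? : ∀ n {P : (Fin n → Fin k) → Set} → (∀ f → Dec (P f)) →
              (∀ {f g} → (∀ x → f x ≡ g x) → P f → P g) → Dec (∃ P)
∃-function? zero P? resp with P? (λ ())
... | yes p  = yes (_ , p)
... | no  ¬p = no λ (g , pg) → ¬p (resp (λ ()) pg)
∃-function? (suc n) P? resp
  with any? (λ a → ∃-function? n (λ h → P? (a ∷ᵛ h))
                     (λ h≗g → resp λ { zero → refl ; (suc i) → h≗g i }))
... | yes (a , h , p) = yes (a ∷ᵛ h , p)
... | no  ¬p = no λ (g , pg) → ¬p (head g , tail g , resp (λ { zero → refl ; (suc i) → refl }) pg)

module _ {F : Set} (P : F → Set) (w : F → ℕ)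
         (improvement? : ∀ m → Dec (∃ λ g → P g × w g < m)) where

  minimiser : ∀ f → P f → ∃ λ g → P g × (∀ h → P h → w g ≤ w h)
  minimiser f pf = descend f pf (<-wellFounded (w f))
    where
    descend : ∀ f → P f → Acc _<_ (w f) → ∃ λ g → P g × (∀ h → P h → w g ≤ w h)
    descend f pf (acc smaller) with improvement? (w f)
    ... | yes (g , pg , g<f) = descend g pg (smaller g<f)
    ... | no  none = f , pf , λ h ph → ≮⇒≥ λ h<f → none (h , ph , h<f)

module _ {n k} (t : Fin k → Fin n) where

  multiterminalCut-exists : Injective _≡_ _≡_ t → 1 ≤ k → ∃ (IsMultiterminalCut t)
  multiterminalCut-exists inj 1≤k = label , label-terminal
    where
    label : Fin n → Fin k
    label x with any? (λ j → t j ≟ᶠ x)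
    ... | yes (j , _) = j
    ... | no  _       = fromℕ< 1≤k
    label-terminal : ∀ j → label (t j) ≡ j
    label-terminal j with any? (λ i → t i ≟ᶠ t j)
    ... | yes (i , tᵢ≡tⱼ) = inj tᵢ≡tⱼ
    ... | no  none        = ⊥-elim (none (j , refl))

  minMultiterminalCut-exists : (G : Graph n) → ∃ (IsMultiterminalCut t) → ∃ (IsMinMultiterminalCut G t)
  minMultiterminalCut-exists G (f , isCut) = minimiser (IsMultiterminalCut t) (mtcWeight G) cheaperCut? f isCut
    where
    cheaperCut? : ∀ m → Dec (∃ λ g → IsMultiterminalCut t g × mtcWeight G g < m)
    cheaperCut? m = ∃-function? n (λ g → all? (λ j → g (t j) ≟ᶠ j) ×-dec (mtcWeight G g <? m))
      λ f≗g (isCut , f<m) → (λ j → trans (sym (f≗g (t j))) (isCut j))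
                          , subst (_< m) (cutWeightBy-cong finEq f≗g (edges G)) f<m

mainTheorem9 : ∀ {n k} (G : Graph n) (t : Fin k → Fin n) →
  Injective _≡_ _≡_ t → 1 ≤ k →
  (v : Fin n) → (∀ j → ¬ (t j ≡ v)) →
  (Vv : Subset n) → IsLargestMinIsolating G t v Vv →
  Σ (Fin n → Fin k) λ f →
    IsMinMultiterminalCut G t f × (∀ x → x ∈ Vv → f x ≡ f v)
mainTheorem9 G t inj 1≤k v _ Vv (minIsolating@((v∈Vv , _) , _) , _)
  with minMultiterminalCut-exists t G (multiterminalCut-exists t inj 1≤k)
... | f , isMin =
  moveTo Vv (f v) f ,
  moveTo-isMinMultiterminalCut G f minIsolating isMin ,
  λ x x∈Vv → trans (moveTo-∈ (f v) f x∈Vv) (sym (moveTo-∈ (f v) f v∈Vv))
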